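{- Let $m_1=p_1^{e_1}\cdots p_r^{e_r}$ be a product of powers of $r>1$ distinct odd primes and $m_2=q_1^{c_1}\cdots q_\ell^{c_\ell}$ a product of powers of $\ell>1$ distinct odd primes, with $\gcd(m_1,m_2)=1$, and let $m=m_1m_2$. Let $t_1,t_2,t$ be the multiplicative orders of $2$ modulo $m_1,m_2,m$ respectively, so that $\mathbf{F}_{2^{t_1}}$ and $\mathbf{F}_{2^{t_2}}$ are subfields of $\mathbf{F}_{2^t}$. Let $\gamma\in\mathbf{F}_{2^t}$ have order $m$, $\gamma_1\in\mathbf{F}_{2^{t_1}}$ have order $m_1$ and $\gamma_2\in\mathbf{F}_{2^{t_2}}$ have order $m_2$. Suppose $P_1(x)\in\mathbf{F}_{2^{t_1}}[x]$ is an $S_{m_1}$-decoding polynomial with respect to $\gamma_1$ having $k_1$ monomials, and $P_2(x)\in\mathbf{F}_{2^{t_2}}[x]$ is an $S_{m_2}$-decoding polynomial with respect to $\gamma_2$ having $k_2$ monomials. Then there is an $S_m$-decoding polynomial $P(x)\in\mathbf{F}_{2^t}[x]$ with respect to $\gamma$ having $k\le k_1k_2$ monomials; consequently, for all integers $n,h\ge1$ and every family of $S_m$-matching vectors $\vec u_1,\dots,\vec u_n\in\mathbf{Z}_m^h$, the code $C:\mathbf{F}_{2^t}^n\to\mathbf{F}_{2^t}^N$, $N=m^h$, built from $\gamma$, $P$ and $\vec u_1,\dots,\vec u_n$ is a $k$-query locally decodable code: its decoders $D_i$ make $k$ queries and satisfy $D_i(C(\vec x))=x_i$ with probability $1$ for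 every $\vec x\in\mathbf{F}_{2^t}^n$ and every $i\in[1,n]$.
   Context: For $m=\prod_i p_i^{e_i}$ (distinct primes $p_i$, $e_i\ge1$), the canonical set is $S_m=\{s\in\mathbf{Z}_m\setminus\{0\}:\ \text{for each } i,\ s\equiv 0 \text{ or } s\equiv 1 \pmod{p_i^{e_i}}\}$. For $\vec x,\vec y\in\mathbf{Z}_m^h$, $\langle\vec x,\vec y\rangle_m=\sum_j x_jy_j \bmod m$. Vectors $\vec u_1,\dots,\vec u_n\in\mathbf{Z}_m^h$ are $S$-matching if $\langle\vec u_i,\vec u_i\rangle_m=0$ for all $i$ and $\langle\vec u_i,\vec u_j\rangle_m\in S$ for all $i\ne j$. For $\gamma$ of order $m$ in a field, a polynomial $P$ is an $S$-decoding polynomial (with respect to $\gamma$) if $P(\gamma^s)=0$ for all $s\in S$ and $P(1)=1$. Construction: write $P(x)=\sum_{j=0}^{k-1}a_jx^{b_j}$ with distinct exponents $b_j$. Coordinates of $\mathbf{F}_{2^t}^N$ are indexed by $\vec z\in\mathbf{Z}_m^h$; $C(\vec x)=\sum_{i=1}^n x_iC(\vec e_i)$ with $C(\vec e_i)=(\gamma^{\langle\vec u_i,\vec z\rangle_m})_{\vec z\in\mathbf{Z}_m^h}$. Decoder $D_i$ on input $\vec y$: choose $\vec v\in\mathbf{Z}_m^h$ uniformly, query $\vec y(\vec v+b_j\vec u_i)$ for $j=0,\dots,k-1$, output $\gamma^{ -\langle\vec u_i,\vec v\rangle_m}\sum_{j}a_j\vec y(\vec v+b_j\vec u_i)$. 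-}

module Defs where

open import Level using (Level; _⊔_)
open import Data.Nat using (ℕ; zero; suc; _+_; _*_; _∸_; _^_; _≤_; _<_; _%_; NonZero)
open import Data.Nat.DivMod using (m%n<n)
open import Data.Nat.Divisibility using (_∣_)
open import Data.Nat.Primality using (Prime)
open import Data.Fin using (Fin; toℕ; fromℕ<)
import Data.Fin as F
open import Data.List using (List; []; _∷_; map)
open import Data.List.Relation.Unary.All using (All)
open import Data.List.Relation.Unary.Unique.Propositional using (Unique)
open import Data.Product using (Σ; _×_; _,_; proj₁; proj₂)
open import Data.Sum using (_⊎_)
open import Relation.Nullary using (¬_)
open import Relation.Binary.PropositionalEquality using (_≡_; _≢_)
open import Algebra.Bundles using (CommutativeRing)

prodFin : (r : ℕ) → (Fin r → ℕ) → ℕ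
prodFin zero    f = 1
prodFin (suc r) f = f F.zero * prodFin r (λ i → f (F.suc i))

sumFin : (r : ℕ) → (Fin r → ℕ) → ℕ
sumFin zero    f = 0
sumFin (suc r) f = f F.zero + sumFin r (λ i → f (F.suc i))

-- reduction modulo m (total; only used with m ≥ 1)
_mod′_ : ℕ → ℕ → ℕ
x mod′ zero  = x
x mod′ suc n = x % suc n

record MultOrder (a m t : ℕ) : Set where
  field
    order-pos   : 1 ≤ t
    order-one   : m ∣ (a ^ t ∸ 1)
    order-least : ∀ j → 1 ≤ j → j < t → ¬ (m ∣ (a ^ j ∸ 1))

record OddPrimePowerFactorization (m r : ℕ) : Set where
  field
    p e      : Fin r → ℕ
    prime    : ∀ i → Prime (p i)
    odd      : ∀ i → ¬ (2 ∣ p i)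
    exp-pos  : ∀ i → 1 ≤ e i
    distinct : ∀ i j → p i ≡ p j → i ≡ j
    product  : m ≡ prodFin r (λ i → p i ^ e i)

-- membership in the canonical set S_m (elements of Z_m represented by 0..m-1):
-- s ≠ 0 and for every exact prime-power divisor p^e of m, s ≡ 0 or s ≡ 1 (mod p^e)
InS : ℕ → ℕ → Set
InS m s = s < m × 1 ≤ s ×
  (∀ p e → Prime p → 1 ≤ e → p ^ e ∣ m → ¬ (p ^ suc e ∣ m) →
     (p ^ e ∣ s) ⊎ (p ^ e ∣ (s ∸ 1)))

ZVec : ℕ → ℕ → Set
ZVec m h = Fin h → Fin m

ip : (m h : ℕ) → ZVec m h → ZVec m h → ℕ
ip m h x y = sumFin h (λ j → toℕ (x j) * toℕ (y j)) mod′ m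

shift : (m h : ℕ) .{{_ : NonZero m}} → ZVec m h → ℕ → ZVec m h → ZVec m h
shift m h v b u j = fromℕ< (m%n<n (toℕ (v j) + b * toℕ (u j)) m)

Matching : (m h n : ℕ) → (Fin n → ZVec m h) → Set
Matching m h n u =
  (∀ i → ip m h (u i) (u i) ≡ 0) ×
  (∀ i j → i ≢ j → InS m (ip m h (u i) (u j)))

-- Field-side notions, over a commutative ring R (made a field by hypothesis)

module _ {c ℓ : Level} (R : CommutativeRing c ℓ) where
  open CommutativeRing R using (Carrier; _≈_; 0#; 1#) renaming (_+_ to _+ᶠ_; _*_ to _*ᶠ_)

  pow : Carrier → ℕ → Carrier
  pow x zero    = 1#
  pow x (suc n) = x *ᶠ pow x n

  record IsFiniteFieldOfSize (q : ℕ) : Set (c ⊔ ℓ) where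
    field
      nontrivial : ¬ (1# ≈ 0#)
      inverse    : ∀ x → ¬ (x ≈ 0#) → Σ Carrier λ y → x *ᶠ y ≈ 1#
      enum       : Fin q → Carrier
      enum-inj   : ∀ i j → enum i ≈ enum j → i ≡ j
      enum-surj  : ∀ x → Σ (Fin q) λ i → enum i ≈ x

  InSubfield : ℕ → Carrier → Set ℓ
  InSubfield s x = pow x (2 ^ s) ≈ x

  HasOrder : Carrier → ℕ → Set ℓ
  HasOrder γ m = pow γ m ≈ 1# × (∀ j → 1 ≤ j → j < m → ¬ (pow γ j ≈ 1#))

  sumF : (n : ℕ) → (Fin n → Carrier) → Carrier
  sumF zero    f = 0#
  sumF (suc n) f = f F.zero +ᶠ sumF n (λ i → f (F.suc i))

  -- a polynomial written as a list of monomials a_j x^{b_j}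
  SparsePoly : Set c
  SparsePoly = List (Carrier × ℕ)

  -- nonzero coefficients and pairwise distinct exponents; then the
  -- number of monomials of the polynomial is the length of the list
  WellFormed : SparsePoly → Set (c ⊔ ℓ)
  WellFormed P = All (λ ab → ¬ (proj₁ ab ≈ 0#)) P × Unique (map proj₂ P)

  CoeffsIn : ℕ → SparsePoly → Set (c ⊔ ℓ)
  CoeffsIn s P = All (λ ab → InSubfield s (proj₁ ab)) P

  eval : SparsePoly → Carrier → Carrier
  eval []             x = 0#
  eval ((a , b) ∷ P) x = a *ᶠ pow x b +ᶠ eval P x

  IsDecoding : ℕ → Carrier → SparsePoly → Set ℓ
  IsDecoding m γ P = (∀ s → InS m s → eval P (pow γ s) ≈ 0#) × eval P 1# ≈ 1#

  encode : (m h n : ℕ) → Carrier → (Fin n → ZVec m h) → (Fin n → Carrier) → ZVec m h → Carrier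
  encode m h n γ u x z = sumF n (λ i → x i *ᶠ pow γ (ip m h (u i) z))

  querySum : (m h : ℕ) .{{_ : NonZero m}} → SparsePoly → (ZVec m h → Carrier) → ZVec m h → ZVec m h → Carrier
  querySum m h []             y v u = 0#
  querySum m h ((a , b) ∷ P) y v u = a *ᶠ y (shift m h v b u) +ᶠ querySum m h P y v u

  -- decoder D_i on received word y with random choice v
  -- (γ^{-⟨u_i,v⟩} is written γ^{m - ⟨u_i,v⟩}, valid as γ^m = 1 and ⟨u_i,v⟩ < m)
  decode : (m h n : ℕ) .{{_ : NonZero m}} → Carrier → SparsePoly → (Fin n → ZVec m h) → Fin n →
           (ZVec m h → Carrier) → ZVec m h → Carrier
  decode m h n γ P u i y v = pow γ (m ∸ ip m h (u i) v) *ᶠ querySum m h P y v (u i)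

module Submission where

-- Write γ₁ = γ ^ α and γ₂ = γ ^ β. Such exponents exist because γ ^ m₂ has order m₁ and in a field
-- the m₁-th roots of unity are exactly its powers (X ^ m₁ − 1 has at most m₁ roots); likewise for γ₂.
-- By the Chinese remainder theorem, for s ∈ S_{m₁m₂} either s mod m₁ ∈ S_{m₁} or s mod m₂ ∈ S_{m₂},
-- so P(x) = P₁(x ^ α) · P₂(x ^ β) vanishes at γ ^ s for every s ∈ S_{m₁m₂}, and P(1) = 1; expanding the
-- product and merging equal exponents leaves at most k₁k₂ monomials.
-- Decoding is the matching-vector argument: the query sum is linear in the received word, and on the
-- character z ↦ γ ^ ⟨u_l, z⟩ it equals γ ^ ⟨u_l, v⟩ · P(γ ^ ⟨u_l, u_i⟩), which vanishes for l ≠ i since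
-- ⟨u_l, u_i⟩ ∈ S, and is γ ^ ⟨u_i, v⟩ for l = i since ⟨u_i, u_i⟩ = 0.

open import Defs
open import Data.Nat as ℕ using (ℕ; zero; suc; NonZero; _≤_; _<_; z≤n; s≤s)
import Data.Nat.Properties as ℕₚ
open import Data.Nat.DivMod using (m≡m%n+[m/n]*n; m%n<n)
open import Data.Nat.Divisibility
  using (_∣_; divides; ∣-trans; n∣m*n; m∣m*n; ∣n⇒∣m*n; *-monoˡ-∣; *-monoʳ-∣; *-cancelʳ-∣;
         %-presˡ-∣; ∣m+n∣m⇒∣n; m%n≡0⇒n∣m; ∣⇒≤)
open import Data.Nat.Primality using (Prime; euclidsLemma; prime⇒nonZero; prime⇒nonTrivial)
open import Data.Nat.Coprimality as Coprime using (Coprime; coprime-divisor; gcd≡1⇒coprime)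
open import Data.Nat.GCD using (gcd)
open import Data.Fin as Fin using (Fin; toℕ)
open import Data.Fin.Properties using (punchInᵢ≢i; toℕ-fromℕ<; toℕ-injective; toℕ<n; any?)
open import Data.Product as Product using (Σ; ∃-syntax; _×_; _,_; proj₁; proj₂)
open import Data.Sum using (_⊎_; inj₁; inj₂)
open import Data.Empty using (⊥-elim)
open import Data.List as List using (List; []; _∷_; _++_; length; cartesianProductWith)
open import Data.List.Properties using (length-++; length-map)
open import Data.List.Relation.Unary.All using (All; []; _∷_)
open import Data.List.Relation.Unary.AllPairs using ([]; _∷_)
open import Data.List.Relation.Unary.Unique.Propositional using (Unique)
open import Data.Vec using (Vec; []; _∷_; tabulate)
open import Data.Vec.Relation.Unary.All as VecAll using ([]; _∷_)
import Data.Vec.Relation.Unary.All.Properties as VecAllₚ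
open import Data.Vec.Relation.Unary.AllPairs using (AllPairs; []; _∷_)
import Data.Vec.Relation.Unary.AllPairs.Properties as AllPairsₚ
open import Function using (_∘_)
open import Relation.Nullary using (¬_; yes; no)
open import Relation.Binary.Definitions using (Decidable; tri<; tri≈; tri>)
open import Relation.Binary.PropositionalEquality as ≡ using (_≡_; _≢_)
open import Algebra.Bundles using (CommutativeRing)
import Algebra.Properties.CommutativeSemigroup ℕₚ.*-commutativeSemigroup as ℕ*
import Algebra.Properties.Semiring.Sum ℕₚ.+-*-semiring as ℕΣ

module _ where
  open import Data.Nat using (_+_; _*_; _∸_; _^_; _%_; _/_)

  prodFin-nonZero : ∀ r (f : Fin r → ℕ) → (∀ i → NonZero (f i)) → NonZero (prodFin r f)
  prodFin-nonZero zero    f nz = _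
  prodFin-nonZero (suc r) f nz =
    ℕₚ.m*n≢0 (f Fin.zero) _ {{nz Fin.zero}} {{prodFin-nonZero r (f ∘ Fin.suc) (nz ∘ Fin.suc)}}

  factorization-nonZero : ∀ {m r} → OddPrimePowerFactorization m r → NonZero m
  factorization-nonZero {r = r} F = ≡.subst NonZero (≡.sym product)
    (prodFin-nonZero r _ (λ i → ℕₚ.m^n≢0 (p i) (e i) {{prime⇒nonZero (prime i)}}))
    where open OddPrimePowerFactorization F

  p^k∣m*n⇒p^k∣m : ∀ {p m n} → Prime p → ¬ p ∣ n → ∀ k → p ^ k ∣ m * n → p ^ k ∣ m
  p^k∣m*n⇒p^k∣m {m = m} _ _ zero _ = divides m (≡.sym (ℕₚ.*-identityʳ m))
  p^k∣m*n⇒p^k∣m {p} {m} {n} p-prime p∤n (suc k) p^[1+k]∣mn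
    with p^k∣m*n⇒p^k∣m {m = m} p-prime p∤n k (∣-trans (n∣m*n p) p^[1+k]∣mn)
  ... | divides c ≡.refl = *-monoˡ-∣ (p ^ k) p∣c
    where
      instance _ = ℕₚ.m^n≢0 p k {{prime⇒nonZero p-prime}}
      p∣cn : p ∣ c * n
      p∣cn = *-cancelʳ-∣ (p ^ k) (≡.subst (p * p ^ k ∣_) (ℕ*.xy∙z≈xz∙y c (p ^ k) n) p^[1+k]∣mn)
      p∣c : p ∣ c
      p∣c with euclidsLemma c n p-prime p∣cn
      ... | inj₁ p∣c = p∣c
      ... | inj₂ p∣n = ⊥-elim (p∤n p∣n)

  InS-%-factor : ∀ A B s .{{_ : NonZero A}} → Coprime A B → InS (A * B) s → s % A ≢ 0 → InS A (s % A)
  InS-%-factor A B s A⊥B (_ , _ , s∈S) s%A≢0 =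
    m%n<n s A , ℕₚ.n≢0⇒n>0 s%A≢0 , λ p e p-prime e≥1 pᵉ∣A pᵉ⁺¹∤A →
      reduce (p ^ e) pᵉ∣A (s∈S p e p-prime e≥1 (∣-trans pᵉ∣A (m∣m*n B)) (pᵉ⁺¹∤A ∘ cancel p-prime pᵉ∣A e≥1))
    where
      cancel : ∀ {p e} → Prime p → p ^ e ∣ A → 1 ≤ e → p ^ suc e ∣ A * B → p ^ suc e ∣ A
      cancel {p} {suc e} p-prime pᵉ∣A _ =
        p^k∣m*n⇒p^k∣m p-prime (λ p∣B → ℕ.nonTrivial⇒≢1 {{prime⇒nonTrivial p-prime}}
          (A⊥B (∣-trans (m∣m*n (p ^ e)) pᵉ∣A , p∣B))) (suc (suc e))
      s∸1≡ : s ∸ 1 ≡ (s / A) * A + (s % A ∸ 1)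
      s∸1≡ = ≡.trans (≡.cong (_∸ 1) (m≡m%n+[m/n]*n s A))
               (≡.trans (ℕₚ.+-∸-comm _ (ℕₚ.n≢0⇒n>0 s%A≢0)) (ℕₚ.+-comm (s % A ∸ 1) _))
      reduce : ∀ d → d ∣ A → d ∣ s ⊎ d ∣ (s ∸ 1) → d ∣ s % A ⊎ d ∣ (s % A ∸ 1)
      reduce d d∣A (inj₁ d∣s)   = inj₁ (%-presˡ-∣ d∣s d∣A)
      reduce d d∣A (inj₂ d∣s∸1) = inj₂ (∣m+n∣m⇒∣n (≡.subst (d ∣_) s∸1≡ d∣s∸1) (∣n⇒∣m*n (s / A) d∣A))

  InS-*-split : ∀ A B s .{{_ : NonZero A}} .{{_ : NonZero B}} → Coprime A B → InS (A * B) s →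
                InS A (s % A) ⊎ InS B (s % B)
  InS-*-split A B s A⊥B s∈S@(s<AB , s≥1 , _) with s % A ℕ.≟ 0 | s % B ℕ.≟ 0
  ... | no s%A≢0 | _         = inj₁ (InS-%-factor A B s A⊥B s∈S s%A≢0)
  ... | yes _    | no s%B≢0  =
    inj₂ (InS-%-factor B A s (Coprime.sym A⊥B) (≡.subst (λ M → InS M s) (ℕₚ.*-comm A B) s∈S) s%B≢0)
  ... | yes s%A≡0 | yes s%B≡0 = ⊥-elim (ℕₚ.<⇒≱ s<AB (∣⇒≤ {{ℕ.>-nonZero s≥1}} AB∣s))
    where
      AB∣s : A * B ∣ s
      AB∣s with m%n≡0⇒n∣m s A s%A≡0
      ... | divides k ≡.refl = ≡.subst (A * B ∣_) (ℕₚ.*-comm A k) (*-monoʳ-∣ A B∣k)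
        where
          B∣k : B ∣ k
          B∣k = coprime-divisor (Coprime.sym A⊥B) (≡.subst (B ∣_) (ℕₚ.*-comm k A) (m%n≡0⇒n∣m _ B s%B≡0))

  sumFin≡∑ : ∀ n (f : Fin n → ℕ) → sumFin n f ≡ ℕΣ.sum f
  sumFin≡∑ zero    f = ≡.refl
  sumFin≡∑ (suc n) f = ≡.cong (f Fin.zero +_) (sumFin≡∑ n (f ∘ Fin.suc))

  sumFin-linear : ∀ h (w v u : Fin h → ℕ) b →
    sumFin h (λ j → w j * (v j + b * u j)) ≡ sumFin h (λ j → w j * v j) + b * sumFin h (λ j → w j * u j)
  sumFin-linear h w v u b = begin
    sumFin h (λ j → w j * (v j + b * u j))   ≡⟨ sumFin≡∑ h _ ⟩
    ∑ (λ j → w j * (v j + b * u j))          ≡⟨ ℕΣ.sum-cong-≗ distrib ⟩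
    ∑ (λ j → w j * v j + b * (w j * u j))
      ≡⟨ ℕΣ.∑-distrib-+ (λ j → w j * v j) (λ j → b * (w j * u j)) ⟩
    ∑ (λ j → w j * v j) + ∑ (λ j → b * (w j * u j))
      ≡⟨ ≡.cong (_ +_) (ℕΣ.*-distribˡ-sum b (λ j → w j * u j)) ⟨
    ∑ (λ j → w j * v j) + b * ∑ (λ j → w j * u j)
      ≡⟨ ≡.cong₂ (λ x y → x + b * y) (sumFin≡∑ h _) (sumFin≡∑ h _) ⟨
    sumFin h (λ j → w j * v j) + b * sumFin h (λ j → w j * u j) ∎
    where
      open ≡.≡-Reasoning
      ∑ : (Fin h → ℕ) → ℕ
      ∑ = ℕΣ.sum
      distrib : ∀ j → w j * (v j + b * u j) ≡ w j * v j + b * (w j * u j)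
      distrib j = ≡.trans (ℕₚ.*-distribˡ-+ (w j) (v j) _)
                          (≡.cong (w j * v j +_) (ℕ*.x∙yz≈y∙xz (w j) b (u j)))

  mod′≡% : ∀ M .{{_ : NonZero M}} x → x mod′ M ≡ x % M
  mod′≡% (suc M) x = ≡.refl

module Powers {c ℓ} (R : CommutativeRing c ℓ) where
  open CommutativeRing R
  open import Algebra.Properties.Semiring.Exp semiring using (_^_; ^-congˡ; ^-homo-*; ^-assocʳ)

  pow≡^ : ∀ x n → pow R x n ≡ x ^ n
  pow≡^ x zero    = ≡.refl
  pow≡^ x (suc n) = ≡.cong (x *_) (pow≡^ x n)

  pow-cong : ∀ n {x y} → x ≈ y → pow R x n ≈ pow R y n
  pow-cong n {x} {y} x≈y rewrite pow≡^ x n | pow≡^ y n = ^-congˡ n x≈y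

  pow-+ : ∀ x m n → pow R x (m ℕ.+ n) ≈ pow R x m * pow R x n
  pow-+ x m n rewrite pow≡^ x (m ℕ.+ n) | pow≡^ x m | pow≡^ x n = ^-homo-* x m n

  pow-* : ∀ x m n → pow R x (m ℕ.* n) ≈ pow R (pow R x m) n
  pow-* x m n rewrite pow≡^ x (m ℕ.* n) | pow≡^ x m | pow≡^ (x ^ m) n = sym (^-assocʳ x m n)

  pow-1# : ∀ n → pow R 1# n ≈ 1#
  pow-1# zero    = refl
  pow-1# (suc n) = trans (*-identityˡ _) (pow-1# n)

  pow-comm : ∀ x m n → pow R (pow R x m) n ≈ pow R (pow R x n) m
  pow-comm x m n = trans (sym (pow-* x m n)) (trans (reflexive (≡.cong (pow R x) (ℕₚ.*-comm m n))) (pow-* x n m))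

  pow-pow≈1 : ∀ x m → pow R x m ≈ 1# → ∀ k → pow R (pow R x k) m ≈ 1#
  pow-pow≈1 x m xᵐ≈1 k = trans (pow-comm x k m) (trans (pow-cong k xᵐ≈1) (pow-1# k))

  pow-% : ∀ x m .{{_ : NonZero m}} → pow R x m ≈ 1# → ∀ a → pow R x (a ℕ.% m) ≈ pow R x a
  pow-% x m xᵐ≈1 a = sym (begin
    pow R x a                                     ≡⟨ ≡.cong (pow R x) (m≡m%n+[m/n]*n a m) ⟩
    pow R x (a ℕ.% m ℕ.+ a ℕ./ m ℕ.* m)           ≈⟨ pow-+ x (a ℕ.% m) _ ⟩
    pow R x (a ℕ.% m) * pow R x (a ℕ./ m ℕ.* m)
      ≈⟨ *-congˡ (trans (pow-* x (a ℕ./ m) m) (pow-pow≈1 x m xᵐ≈1 (a ℕ./ m))) ⟩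
    pow R x (a ℕ.% m) * 1#                        ≈⟨ *-identityʳ _ ⟩
    pow R x (a ℕ.% m)                             ∎)
    where open import Relation.Binary.Reasoning.Setoid setoid

module SparsePolynomials {c ℓ} (R : CommutativeRing c ℓ) where
  open CommutativeRing R
  open Powers R
  open import Algebra.Properties.CommutativeSemigroup *-commutativeSemigroup
    using () renaming (interchange to *-interchange)
  open import Relation.Binary.Reasoning.Setoid setoid

  eval-cong : ∀ P {x y} → x ≈ y → eval R P x ≈ eval R P y
  eval-cong []            x≈y = refl
  eval-cong ((a , b) ∷ P) x≈y = +-cong (*-congˡ (pow-cong b x≈y)) (eval-cong P x≈y)

  eval-++ : ∀ P Q x → eval R (P ++ Q) x ≈ eval R P x + eval R Q x
  eval-++ []            Q x = sym (+-identityˡ _)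
  eval-++ ((a , b) ∷ P) Q x = trans (+-congˡ (eval-++ P Q x)) (sym (+-assoc _ _ _))

  scaleExponents : ℕ → SparsePoly R → SparsePoly R
  scaleExponents α = List.map (Product.map₂ (α ℕ.*_))

  eval-scaleExponents : ∀ α P x → eval R (scaleExponents α P) x ≈ eval R P (pow R x α)
  eval-scaleExponents α []            x = refl
  eval-scaleExponents α ((a , b) ∷ P) x = +-cong (*-congˡ (pow-* x α b)) (eval-scaleExponents α P x)

  monomial-* : Carrier × ℕ → Carrier × ℕ → Carrier × ℕ
  monomial-* (a , b) (c , d) = a * c , b ℕ.+ d

  infixl 7 _*ₚ_
  _*ₚ_ : SparsePoly R → SparsePoly R → SparsePoly R
  _*ₚ_ = cartesianProductWith monomial-*

  eval-map-monomial-* : ∀ a b Q x → eval R (List.map (monomial-* (a , b)) Q) x ≈ (a * pow R x b) * eval R Q x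
  eval-map-monomial-* a b []            x = sym (zeroʳ _)
  eval-map-monomial-* a b ((c , d) ∷ Q) x = begin
    (a * c) * pow R x (b ℕ.+ d) + eval R (List.map (monomial-* (a , b)) Q) x
      ≈⟨ +-cong (*-congˡ (pow-+ x b d)) (eval-map-monomial-* a b Q x) ⟩
    (a * c) * (pow R x b * pow R x d) + (a * pow R x b) * eval R Q x
      ≈⟨ +-congʳ (*-interchange a c _ _) ⟩
    (a * pow R x b) * (c * pow R x d) + (a * pow R x b) * eval R Q x
      ≈⟨ distribˡ _ _ _ ⟨
    (a * pow R x b) * (c * pow R x d + eval R Q x) ∎

  eval-*ₚ : ∀ P Q x → eval R (P *ₚ Q) x ≈ eval R P x * eval R Q x
  eval-*ₚ []            Q x = sym (zeroˡ _)
  eval-*ₚ ((a , b) ∷ P) Q x = begin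
    eval R (List.map (monomial-* (a , b)) Q ++ P *ₚ Q) x
      ≈⟨ eval-++ (List.map (monomial-* (a , b)) Q) (P *ₚ Q) x ⟩
    eval R (List.map (monomial-* (a , b)) Q) x + eval R (P *ₚ Q) x
      ≈⟨ +-cong (eval-map-monomial-* a b Q x) (eval-*ₚ P Q x) ⟩
    (a * pow R x b) * eval R Q x + eval R P x * eval R Q x
      ≈⟨ distribʳ _ _ _ ⟨
    (a * pow R x b + eval R P x) * eval R Q x ∎

  length-*ₚ : ∀ (P Q : SparsePoly R) → length (P *ₚ Q) ≡ length P ℕ.* length Q
  length-*ₚ []      Q = ≡.refl
  length-*ₚ (m ∷ P) Q = ≡.trans (length-++ (List.map (monomial-* m) Q))
    (≡.cong₂ ℕ._+_ (length-map (monomial-* m) Q) (length-*ₚ P Q))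

  *ₚ-isDecoding : ∀ {m₁ m₂ γ γ₁ γ₂} α β P₁ P₂ .{{_ : NonZero m₁}} .{{_ : NonZero m₂}} →
    Coprime m₁ m₂ → pow R γ₁ m₁ ≈ 1# → pow R γ₂ m₂ ≈ 1# → pow R γ α ≈ γ₁ → pow R γ β ≈ γ₂ →
    IsDecoding R m₁ γ₁ P₁ → IsDecoding R m₂ γ₂ P₂ →
    IsDecoding R (m₁ ℕ.* m₂) γ (scaleExponents α P₁ *ₚ scaleExponents β P₂)
  *ₚ-isDecoding {m₁} {m₂} {γ} {γ₁} {γ₂} α β P₁ P₂ m₁⊥m₂ γ₁ᵐ¹≈1 γ₂ᵐ²≈1 γᵅ≈γ₁ γᵝ≈γ₂
    (P₁-vanishes , P₁[1]≈1) (P₂-vanishes , P₂[1]≈1) = vanishes , one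
    where
      Q : SparsePoly R
      Q = scaleExponents α P₁ *ₚ scaleExponents β P₂
      eval-product : ∀ x → eval R Q x ≈ eval R P₁ (pow R x α) * eval R P₂ (pow R x β)
      eval-product x = trans (eval-*ₚ (scaleExponents α P₁) _ x)
                             (*-cong (eval-scaleExponents α P₁ x) (eval-scaleExponents β P₂ x))
      reduce : ∀ {δ} e m .{{_ : NonZero m}} → pow R γ e ≈ δ → pow R δ m ≈ 1# →
               ∀ s → pow R (pow R γ s) e ≈ pow R δ (s ℕ.% m)
      reduce {δ} e m γᵉ≈δ δᵐ≈1 s =
        trans (pow-comm γ s e) (trans (pow-cong s γᵉ≈δ) (sym (pow-% δ m δᵐ≈1 s)))
      vanishes : ∀ s → InS (m₁ ℕ.* m₂) s → eval R Q (pow R γ s) ≈ 0#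
      vanishes s s∈S with InS-*-split m₁ m₂ s m₁⊥m₂ s∈S
      ... | inj₁ s∈S₁ = trans (eval-product _) (trans (*-congʳ
              (trans (eval-cong P₁ (reduce α m₁ γᵅ≈γ₁ γ₁ᵐ¹≈1 s)) (P₁-vanishes _ s∈S₁))) (zeroˡ _))
      ... | inj₂ s∈S₂ = trans (eval-product _) (trans (*-congˡ
              (trans (eval-cong P₂ (reduce β m₂ γᵝ≈γ₂ γ₂ᵐ²≈1 s)) (P₂-vanishes _ s∈S₂))) (zeroʳ _))
      one : eval R Q 1# ≈ 1#
      one = trans (eval-product 1#) (trans (*-cong (trans (eval-cong P₁ (pow-1# α)) P₁[1]≈1)
                                                   (trans (eval-cong P₂ (pow-1# β)) P₂[1]≈1)) (*-identityˡ 1#))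

module Normalization {c ℓ} (R : CommutativeRing c ℓ) (_≟_ : Decidable (CommutativeRing._≈_ R)) where
  open CommutativeRing R
  open import Algebra.Properties.CommutativeSemigroup +-commutativeSemigroup using (x∙yz≈y∙xz)
  open import Relation.Binary.Reasoning.Setoid setoid

  insert : Carrier × ℕ → SparsePoly R → SparsePoly R
  insert (a , b) [] with a ≟ 0#
  ... | yes _ = []
  ... | no  _ = (a , b) ∷ []
  insert (a , b) ((a′ , b′) ∷ P) with b ℕ.≟ b′
  ... | no  _ = (a′ , b′) ∷ insert (a , b) P
  ... | yes _ with (a + a′) ≟ 0#
  ...   | yes _ = P
  ...   | no  _ = (a + a′ , b′) ∷ P

  normalize : SparsePoly R → SparsePoly R
  normalize = List.foldr insert []

  eval-insert : ∀ a b P x → eval R (insert (a , b) P) x ≈ a * pow R x b + eval R P x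
  eval-insert a b [] x with a ≟ 0#
  ... | yes a≈0 = sym (trans (+-identityʳ _) (trans (*-congʳ a≈0) (zeroˡ _)))
  ... | no  _   = refl
  eval-insert a b ((a′ , b′) ∷ P) x with b ℕ.≟ b′
  ... | no _ = trans (+-congˡ (eval-insert a b P x)) (x∙yz≈y∙xz _ _ _)
  ... | yes ≡.refl with (a + a′) ≟ 0#
  ...   | yes a+a′≈0 = sym (begin
    a * pow R x b + (a′ * pow R x b + eval R P x)   ≈⟨ +-assoc _ _ _ ⟨
    (a * pow R x b + a′ * pow R x b) + eval R P x   ≈⟨ +-congʳ (distribʳ _ a a′) ⟨
    (a + a′) * pow R x b + eval R P x               ≈⟨ +-congʳ (trans (*-congʳ a+a′≈0) (zeroˡ _)) ⟩
    0# + eval R P x                                 ≈⟨ +-identityˡ _ ⟩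
    eval R P x                                      ∎)
  ...   | no  _ = trans (+-congʳ (distribʳ _ a a′)) (+-assoc _ _ _)

  eval-normalize : ∀ P x → eval R (normalize P) x ≈ eval R P x
  eval-normalize []            x = refl
  eval-normalize ((a , b) ∷ P) x = trans (eval-insert a b (normalize P) x) (+-congˡ (eval-normalize P x))

  length-insert : ∀ m P → length (insert m P) ≤ suc (length P)
  length-insert (a , b) [] with a ≟ 0#
  ... | yes _ = z≤n
  ... | no  _ = ℕₚ.≤-refl
  length-insert (a , b) ((a′ , b′) ∷ P) with b ℕ.≟ b′
  ... | no _ = s≤s (length-insert (a , b) P)
  ... | yes ≡.refl with (a + a′) ≟ 0#
  ...   | yes _ = ℕₚ.m≤n⇒m≤1+n (ℕₚ.n≤1+n _)
  ...   | no  _ = ℕₚ.n≤1+n _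

  length-normalize : ∀ P → length (normalize P) ≤ length P
  length-normalize []      = z≤n
  length-normalize (m ∷ P) = ℕₚ.≤-trans (length-insert m (normalize P)) (s≤s (length-normalize P))

  insert-nonzero : ∀ m P → All (λ ab → ¬ proj₁ ab ≈ 0#) P → All (λ ab → ¬ proj₁ ab ≈ 0#) (insert m P)
  insert-nonzero (a , b) [] _ with a ≟ 0#
  ... | yes _   = []
  ... | no  a≉0 = a≉0 ∷ []
  insert-nonzero (a , b) ((a′ , b′) ∷ P) (a′≉0 ∷ P≉0) with b ℕ.≟ b′
  ... | no _ = a′≉0 ∷ insert-nonzero (a , b) P P≉0
  ... | yes ≡.refl with (a + a′) ≟ 0#
  ...   | yes _       = P≉0
  ...   | no  a+a′≉0 = a+a′≉0 ∷ P≉0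

  insert-exponents : ∀ {p} (Q : ℕ → Set p) a b P → All Q (List.map proj₂ P) → Q b →
                     All Q (List.map proj₂ (insert (a , b) P))
  insert-exponents Q a b [] _ Qb with a ≟ 0#
  ... | yes _ = []
  ... | no  _ = Qb ∷ []
  insert-exponents Q a b ((a′ , b′) ∷ P) (Qb′ ∷ QP) Qb with b ℕ.≟ b′
  ... | no _ = Qb′ ∷ insert-exponents Q a b P QP Qb
  ... | yes ≡.refl with (a + a′) ≟ 0#
  ...   | yes _ = QP
  ...   | no  _ = Qb′ ∷ QP

  insert-unique : ∀ a b P → Unique (List.map proj₂ P) → Unique (List.map proj₂ (insert (a , b) P))
  insert-unique a b [] _ with a ≟ 0#
  ... | yes _ = []
  ... | no  _ = [] ∷ []
  insert-unique a b ((a′ , b′) ∷ P) (b′∉P ∷ P-unique) with b ℕ.≟ b′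
  ... | no b≢b′ = insert-exponents (b′ ≢_) a b P b′∉P (b≢b′ ∘ ≡.sym) ∷ insert-unique a b P P-unique
  ... | yes ≡.refl with (a + a′) ≟ 0#
  ...   | yes _ = P-unique
  ...   | no  _ = b′∉P ∷ P-unique

  normalize-isDecoding : ∀ {m γ P} → IsDecoding R m γ P → IsDecoding R m γ (normalize P)
  normalize-isDecoding {P = P} (P-vanishes , P[1]≈1) =
    (λ s s∈S → trans (eval-normalize P _) (P-vanishes s s∈S)) , trans (eval-normalize P 1#) P[1]≈1

  normalize-wellFormed : ∀ P → WellFormed R (normalize P)
  normalize-wellFormed []            = [] , []
  normalize-wellFormed ((a , b) ∷ P) =
    insert-nonzero (a , b) (normalize P) (proj₁ (normalize-wellFormed P)) ,
    insert-unique a b (normalize P) (proj₂ (normalize-wellFormed P))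

module FiniteFields {c ℓ} (R : CommutativeRing c ℓ) {q} (F : IsFiniteFieldOfSize R q) where
  open CommutativeRing R
  open IsFiniteFieldOfSize F
  open Powers R
  open import Algebra.Properties.CommutativeSemigroup +-commutativeSemigroup
    using () renaming (interchange to +-interchange)
  open import Algebra.Properties.CommutativeSemigroup *-commutativeSemigroup using (x∙yz≈y∙xz)
  open import Relation.Binary.Reasoning.Setoid setoid

  infix 4 _≟_
  _≟_ : Decidable _≈_
  x ≟ y with enum-surj x | enum-surj y
  ... | i , eᵢ≈x | j , eⱼ≈y with i Fin.≟ j
  ... | yes ≡.refl = yes (trans (sym eᵢ≈x) eⱼ≈y)
  ... | no  i≢j    = no (λ x≈y → i≢j (enum-inj i j (trans eᵢ≈x (trans x≈y (sym eⱼ≈y)))))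

  *-cancelˡ : ∀ {x y z} → ¬ x ≈ 0# → x * y ≈ x * z → y ≈ z
  *-cancelˡ {x} {y} {z} x≉0 xy≈xz with inverse x x≉0
  ... | x⁻¹ , xx⁻¹≈1 = begin
    y                ≈⟨ *-identityˡ y ⟨
    1# * y           ≈⟨ *-congʳ (trans (sym xx⁻¹≈1) (*-comm x x⁻¹)) ⟩
    (x⁻¹ * x) * y    ≈⟨ *-assoc x⁻¹ x y ⟩
    x⁻¹ * (x * y)    ≈⟨ *-congˡ xy≈xz ⟩
    x⁻¹ * (x * z)    ≈⟨ *-assoc x⁻¹ x z ⟨
    (x⁻¹ * x) * z    ≈⟨ *-congʳ (trans (*-comm x⁻¹ x) xx⁻¹≈1) ⟩
    1# * z           ≈⟨ *-identityˡ z ⟩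
    z                ∎

  y≉z∧y*x≈z*x⇒x≈0 : ∀ {x y z} → ¬ y ≈ z → y * x ≈ z * x → x ≈ 0#
  y≉z∧y*x≈z*x⇒x≈0 {x} {y} {z} y≉z yx≈zx with x ≟ 0#
  ... | yes x≈0 = x≈0
  ... | no  x≉0 = ⊥-elim (y≉z (*-cancelˡ x≉0 (trans (*-comm x y) (trans yx≈zx (*-comm z x)))))

  pow≉0 : ∀ {x n} → pow R x n ≈ 1# → ∀ {i} → i ≤ n → ¬ pow R x i ≈ 0#
  pow≉0 {x} {n} xⁿ≈1 {i} i≤n xⁱ≈0 = nontrivial (begin
    1#                               ≈⟨ xⁿ≈1 ⟨
    pow R x n                        ≡⟨ ≡.cong (pow R x) (ℕₚ.m+[n∸m]≡n i≤n) ⟨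
    pow R x (i ℕ.+ (n ℕ.∸ i))        ≈⟨ pow-+ x i (n ℕ.∸ i) ⟩
    pow R x i * pow R x (n ℕ.∸ i)    ≈⟨ *-congʳ xⁱ≈0 ⟩
    0# * pow R x (n ℕ.∸ i)           ≈⟨ zeroˡ _ ⟩
    0#                               ∎)

  pow-injective-< : ∀ {ζ n i j} → HasOrder R ζ n → i < j → j < n → ¬ pow R ζ i ≈ pow R ζ j
  pow-injective-< {ζ} {n} {i} {j} (ζⁿ≈1 , minimal) i<j j<n ζⁱ≈ζʲ =
    minimal (j ℕ.∸ i) (ℕₚ.m<n⇒0<n∸m i<j) (ℕₚ.≤-<-trans (ℕₚ.m∸n≤m j i) j<n)
      (sym (*-cancelˡ (pow≉0 ζⁿ≈1 (ℕₚ.<⇒≤ (ℕₚ.<-trans i<j j<n))) (begin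
        pow R ζ i * 1#                   ≈⟨ *-identityʳ _ ⟩
        pow R ζ i                        ≈⟨ ζⁱ≈ζʲ ⟩
        pow R ζ j                        ≡⟨ ≡.cong (pow R ζ) (ℕₚ.m+[n∸m]≡n (ℕₚ.<⇒≤ i<j)) ⟨
        pow R ζ (i ℕ.+ (j ℕ.∸ i))        ≈⟨ pow-+ ζ i (j ℕ.∸ i) ⟩
        pow R ζ i * pow R ζ (j ℕ.∸ i)    ∎)))

  pow-injective : ∀ {ζ n i j} → HasOrder R ζ n → i < n → j < n → pow R ζ i ≈ pow R ζ j → i ≡ j
  pow-injective {i = i} {j} order i<n j<n ζⁱ≈ζʲ with ℕₚ.<-cmp i j
  ... | tri< i<j _ _ = ⊥-elim (pow-injective-< order i<j j<n ζⁱ≈ζʲ)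
  ... | tri≈ _ i≡j _ = i≡j
  ... | tri> _ _ j<i = ⊥-elim (pow-injective-< order j<i i<n (sym ζⁱ≈ζʲ))

  horner : ∀ {n} → Vec Carrier n → Carrier → Carrier
  horner []       x = 0#
  horner (c ∷ cs) x = c + x * horner cs x

  leading : ∀ {n} → Vec Carrier (suc n) → Carrier
  leading (c ∷ [])     = c
  leading (_ ∷ d ∷ cs) = leading (d ∷ cs)

  quotient : ∀ {n} → Carrier → Vec Carrier (suc n) → Vec Carrier n
  quotient a (c ∷ [])     = []
  quotient a (c ∷ d ∷ cs) = horner (d ∷ cs) a ∷ quotient a (d ∷ cs)

  horner-constant : ∀ c x → horner (c ∷ []) x ≈ c
  horner-constant c x = trans (+-congˡ (zeroʳ x)) (+-identityʳ c)

  -- Synthetic division, f(x) − f(a) = (x − a) · q(x), with both sides moved so that no subtraction occurs.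
  horner-quotient : ∀ {n} a x (cs : Vec Carrier (suc n)) →
    horner cs x + a * horner (quotient a cs) x ≈ horner cs a + x * horner (quotient a cs) x
  horner-quotient a x (c ∷ []) =
    +-cong (trans (horner-constant c x) (sym (horner-constant c a))) (trans (zeroʳ a) (sym (zeroʳ x)))
  horner-quotient a x (c ∷ d ∷ cs) = begin
    (c + x * f[x]) + a * (f[a] + x * q[x])        ≈⟨ +-congˡ (distribˡ a f[a] (x * q[x])) ⟩
    (c + x * f[x]) + (a * f[a] + a * (x * q[x]))  ≈⟨ +-interchange c (x * f[x]) (a * f[a]) _ ⟩
    (c + a * f[a]) + (x * f[x] + a * (x * q[x]))  ≈⟨ +-congˡ (+-congˡ (x∙yz≈y∙xz a x q[x])) ⟩
    (c + a * f[a]) + (x * f[x] + x * (a * q[x]))  ≈⟨ +-congˡ (distribˡ x f[x] (a * q[x])) ⟨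
    (c + a * f[a]) + x * (f[x] + a * q[x])        ≈⟨ +-congˡ (*-congˡ (horner-quotient a x (d ∷ cs))) ⟩
    (c + a * f[a]) + x * (f[a] + x * q[x])        ∎
    where
      f[x] = horner (d ∷ cs) x
      f[a] = horner (d ∷ cs) a
      q[x] = horner (quotient a (d ∷ cs)) x

  leading-quotient : ∀ {n} a (cs : Vec Carrier (suc (suc n))) → leading (quotient a cs) ≈ leading cs
  leading-quotient a (c ∷ d ∷ [])     = horner-constant d a
  leading-quotient a (c ∷ d ∷ e ∷ cs) = leading-quotient a (d ∷ e ∷ cs)

  quotient-root : ∀ {n} {a p} (cs : Vec Carrier (suc n)) → horner cs a ≈ 0# → ¬ a ≈ p → horner cs p ≈ 0# →
                  horner (quotient a cs) p ≈ 0#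
  quotient-root {a = a} {p} cs cs[a]≈0 a≉p cs[p]≈0 = y≉z∧y*x≈z*x⇒x≈0 a≉p (begin
    a * q[p]                  ≈⟨ +-identityˡ _ ⟨
    0# + a * q[p]             ≈⟨ +-congʳ cs[p]≈0 ⟨
    horner cs p + a * q[p]    ≈⟨ horner-quotient a p cs ⟩
    horner cs a + p * q[p]    ≈⟨ +-congʳ cs[a]≈0 ⟩
    0# + p * q[p]             ≈⟨ +-identityˡ _ ⟩
    p * q[p]                  ∎)
    where q[p] = horner (quotient a cs) p

  leading≈0 : ∀ {n} (cs ps : Vec Carrier (suc n)) → AllPairs (λ p p′ → ¬ p ≈ p′) ps →
              VecAll.All (λ p → horner cs p ≈ 0#) ps → leading cs ≈ 0#
  leading≈0 (c ∷ [])     (p ∷ []) _ (c[p]≈0 ∷ []) = trans (sym (horner-constant c p)) c[p]≈0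
  leading≈0 (c ∷ d ∷ cs) (a ∷ ps) (a∉ps ∷ ps-distinct) (cs[a]≈0 ∷ cs[ps]≈0) =
    trans (sym (leading-quotient a (c ∷ d ∷ cs)))
      (leading≈0 (quotient a (c ∷ d ∷ cs)) ps ps-distinct
        (VecAll.map (λ (a≉p , cs[p]≈0) → quotient-root (c ∷ d ∷ cs) cs[a]≈0 a≉p cs[p]≈0)
                 (VecAll.zip (a∉ps , cs[ps]≈0))))

  Xᵏ : ∀ k → Vec Carrier (suc k)
  Xᵏ zero    = 1# ∷ []
  Xᵏ (suc k) = 0# ∷ Xᵏ k

  horner-Xᵏ : ∀ k x → horner (Xᵏ k) x ≈ pow R x k
  horner-Xᵏ zero    x = horner-constant 1# x
  horner-Xᵏ (suc k) x = trans (+-identityˡ _) (*-congˡ (horner-Xᵏ k x))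

  leading-Xᵏ : ∀ c k → leading (c ∷ Xᵏ k) ≈ 1#
  leading-Xᵏ c zero    = refl
  leading-Xᵏ c (suc k) = leading-Xᵏ 0# k

  -- X ^ n − 1 has n + 1 coefficients, so it cannot vanish at y as well as at the n distinct powers of ζ.
  root-of-unity≈pow : ∀ {ζ y n} → 1 ≤ n → HasOrder R ζ n → pow R y n ≈ 1# → ∃[ j ] y ≈ pow R ζ j
  root-of-unity≈pow {ζ} {y} {suc k} _ order@(ζⁿ≈1 , _) yⁿ≈1 with any? (λ i → y ≟ pow R ζ (toℕ i))
  ... | yes (i , y≈ζⁱ) = toℕ i , y≈ζⁱ
  ... | no  y∉powers   = ⊥-elim (nontrivial (begin
    1#                     ≈⟨ leading-Xᵏ (- 1#) k ⟨
    leading (- 1# ∷ Xᵏ k)  ≈⟨ leading≈0 (- 1# ∷ Xᵏ k) (y ∷ powers) distinct roots ⟩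
    0#                     ∎))
    where
      powers : Vec Carrier (suc k)
      powers = tabulate (λ i → pow R ζ (toℕ i))
      root : ∀ {x} → pow R x (suc k) ≈ 1# → horner (- 1# ∷ Xᵏ k) x ≈ 0#
      root {x} xⁿ≈1 = trans (+-congˡ (trans (*-congˡ (horner-Xᵏ k x)) xⁿ≈1)) (-‿inverseˡ 1#)
      distinct : AllPairs (λ p p′ → ¬ p ≈ p′) (y ∷ powers)
      distinct = VecAllₚ.tabulate⁺ (λ i y≈ζⁱ → y∉powers (i , y≈ζⁱ)) ∷
        AllPairsₚ.tabulate⁺ (λ i≢j ζⁱ≈ζʲ →
          i≢j (toℕ-injective (pow-injective order (toℕ<n _) (toℕ<n _) ζⁱ≈ζʲ)))
      roots : VecAll.All (λ p → horner (- 1# ∷ Xᵏ k) p ≈ 0#) (y ∷ powers)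
      roots = root yⁿ≈1 ∷ VecAllₚ.tabulate⁺ (λ i → root (pow-pow≈1 ζ (suc k) ζⁿ≈1 (toℕ i)))

  HasOrder-pow : ∀ {γ m k} .{{_ : NonZero k}} → HasOrder R γ (m ℕ.* k) → HasOrder R (pow R γ k) m
  HasOrder-pow {γ} {m} {k} (γᵐᵏ≈1 , minimal) =
    trans (sym (pow-* γ k m)) (trans (reflexive (≡.cong (pow R γ) (ℕₚ.*-comm k m))) γᵐᵏ≈1) ,
    λ j 1≤j j<m γᵏʲ≈1 → minimal (k ℕ.* j) (ℕₚ.*-mono-≤ (ℕ.>-nonZero⁻¹ k) 1≤j)
      (≡.subst (k ℕ.* j <_) (ℕₚ.*-comm k m) (ℕₚ.*-monoʳ-< k j<m)) (trans (pow-* γ k j) γᵏʲ≈1)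

  root-of-unity-exponent : ∀ {γ δ m k} .{{_ : NonZero m}} .{{_ : NonZero k}} →
                           HasOrder R γ (m ℕ.* k) → pow R δ m ≈ 1# → ∃[ α ] pow R γ α ≈ δ
  root-of-unity-exponent {γ} {m = m} {k} order δᵐ≈1
    with root-of-unity≈pow (ℕ.>-nonZero⁻¹ m) (HasOrder-pow order) δᵐ≈1
  ... | j , δ≈γᵏʲ = k ℕ.* j , trans (pow-* γ k j) (sym δ≈γᵏʲ)

module DecodingPolynomials {c ℓ} (R : CommutativeRing c ℓ) {q} (F : IsFiniteFieldOfSize R q) where
  open CommutativeRing R using (_≈_; 1#)
  open FiniteFields R F using (_≟_; root-of-unity-exponent)
  open Normalization R _≟_
  open SparsePolynomials R

  coprime-product : ∀ {m₁ m₂ γ γ₁ γ₂} P₁ P₂ .{{_ : NonZero m₁}} .{{_ : NonZero m₂}} → Coprime m₁ m₂ →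
    HasOrder R γ (m₁ ℕ.* m₂) → pow R γ₁ m₁ ≈ 1# → pow R γ₂ m₂ ≈ 1# →
    IsDecoding R m₁ γ₁ P₁ → IsDecoding R m₂ γ₂ P₂ →
    Σ (SparsePoly R) λ P →
      WellFormed R P × IsDecoding R (m₁ ℕ.* m₂) γ P × length P ≤ length P₁ ℕ.* length P₂
  coprime-product {m₁} {m₂} {γ} {γ₁} {γ₂} P₁ P₂ m₁⊥m₂ γ-order γ₁ᵐ¹≈1 γ₂ᵐ²≈1 P₁-decoding P₂-decoding =
    normalize Q , normalize-wellFormed Q , P-decoding , length-bound
    where
      γ₁-exponent : ∃[ α ] pow R γ α ≈ γ₁
      γ₁-exponent = root-of-unity-exponent γ-order γ₁ᵐ¹≈1
      γ₂-exponent : ∃[ β ] pow R γ β ≈ γ₂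
      γ₂-exponent = root-of-unity-exponent (≡.subst (HasOrder R γ) (ℕₚ.*-comm m₁ m₂) γ-order) γ₂ᵐ²≈1
      α β : ℕ
      α = proj₁ γ₁-exponent
      β = proj₁ γ₂-exponent
      Q : SparsePoly R
      Q = scaleExponents α P₁ *ₚ scaleExponents β P₂
      P-decoding : IsDecoding R (m₁ ℕ.* m₂) γ (normalize Q)
      P-decoding = normalize-isDecoding {P = Q} (*ₚ-isDecoding α β P₁ P₂ m₁⊥m₂ γ₁ᵐ¹≈1 γ₂ᵐ²≈1
                                           (proj₂ γ₁-exponent) (proj₂ γ₂-exponent) P₁-decoding P₂-decoding)
      length-bound : length (normalize Q) ≤ length P₁ ℕ.* length P₂
      length-bound = begin
        length (normalize Q)                                            ≤⟨ length-normalize Q ⟩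
        length Q                                                        ≡⟨ length-*ₚ (scaleExponents α P₁) _ ⟩
        length (scaleExponents α P₁) ℕ.* length (scaleExponents β P₂)
          ≡⟨ ≡.cong₂ ℕ._*_ (length-map _ P₁) (length-map _ P₂) ⟩
        length P₁ ℕ.* length P₂                                         ∎
        where open ℕₚ.≤-Reasoning

module FiniteSums {c ℓ} (R : CommutativeRing c ℓ) where
  open CommutativeRing R
  open import Algebra.Properties.Semiring.Sum semiring
    using (sum; sum-cong-≋; ∑-distrib-+; *-distribˡ-sum; sum-remove; sum-replicate-zero)

  sumF≡sum : ∀ n (f : Fin n → Carrier) → sumF R n f ≡ sum f
  sumF≡sum zero    f = ≡.refl
  sumF≡sum (suc n) f = ≡.cong (f Fin.zero +_) (sumF≡sum n (f ∘ Fin.suc))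

  sumF-cong : ∀ n {f g : Fin n → Carrier} → (∀ i → f i ≈ g i) → sumF R n f ≈ sumF R n g
  sumF-cong n {f} {g} f≈g rewrite sumF≡sum n f | sumF≡sum n g = sum-cong-≋ f≈g

  sumF-zero : ∀ n → sumF R n (λ _ → 0#) ≈ 0#
  sumF-zero n rewrite sumF≡sum n (λ _ → 0#) = sum-replicate-zero n

  sumF-distrib-+ : ∀ n (f g : Fin n → Carrier) → sumF R n (λ i → f i + g i) ≈ sumF R n f + sumF R n g
  sumF-distrib-+ n f g rewrite sumF≡sum n (λ i → f i + g i) | sumF≡sum n f | sumF≡sum n g = ∑-distrib-+ f g

  *-distribˡ-sumF : ∀ n x (f : Fin n → Carrier) → x * sumF R n f ≈ sumF R n (λ i → x * f i)
  *-distribˡ-sumF n x f rewrite sumF≡sum n f | sumF≡sum n (λ i → x * f i) = *-distribˡ-sum x f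

  sumF-single : ∀ n (f : Fin n → Carrier) i → (∀ j → j ≢ i → f j ≈ 0#) → sumF R n f ≈ f i
  sumF-single (suc n) f i f≈0 rewrite sumF≡sum (suc n) f = begin
    sum f                                ≈⟨ sum-remove {i = i} f ⟩
    f i + sum (f ∘ Fin.punchIn i)        ≈⟨ +-congˡ (sum-cong-≋ (λ j → f≈0 _ (punchInᵢ≢i i j))) ⟩
    f i + sum {n} (λ _ → 0#)             ≈⟨ +-congˡ (sum-replicate-zero n) ⟩
    f i + 0#                             ≈⟨ +-identityʳ (f i) ⟩
    f i                                  ∎
    where open import Relation.Binary.Reasoning.Setoid setoid

module MatchingVectorCodes {c ℓ} (R : CommutativeRing c ℓ) (γ : CommutativeRing.Carrier R)
  (M : ℕ) {{_ : NonZero M}} (γᴹ≈1 : CommutativeRing._≈_ R (pow R γ M) (CommutativeRing.1# R)) where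
  open CommutativeRing R
  open Powers R
  open SparsePolynomials R using (eval-cong)
  open FiniteSums R
  open import Algebra.Properties.CommutativeSemigroup *-commutativeSemigroup using (x∙yz≈y∙xz)
  open import Relation.Binary.Reasoning.Setoid setoid

  character : ∀ {h} → ZVec M h → ZVec M h → Carrier
  character {h} w z = pow R γ (ip M h w z)

  pow-sumFin-cong : ∀ k (f g : Fin k → ℕ) → (∀ j → pow R γ (f j) ≈ pow R γ (g j)) →
                    pow R γ (sumFin k f) ≈ pow R γ (sumFin k g)
  pow-sumFin-cong zero    f g fj≈gj = refl
  pow-sumFin-cong (suc k) f g fj≈gj = begin
    pow R γ (f Fin.zero ℕ.+ sumFin k (f ∘ Fin.suc))
      ≈⟨ pow-+ γ (f Fin.zero) _ ⟩
    pow R γ (f Fin.zero) * pow R γ (sumFin k (f ∘ Fin.suc))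
      ≈⟨ *-cong (fj≈gj Fin.zero) (pow-sumFin-cong k _ _ (fj≈gj ∘ Fin.suc)) ⟩
    pow R γ (g Fin.zero) * pow R γ (sumFin k (g ∘ Fin.suc))
      ≈⟨ pow-+ γ (g Fin.zero) _ ⟨
    pow R γ (g Fin.zero ℕ.+ sumFin k (g ∘ Fin.suc)) ∎

  character≈pow-dot : ∀ {h} (w z : ZVec M h) → character w z ≈ pow R γ (sumFin h (λ j → toℕ (w j) ℕ.* toℕ (z j)))
  character≈pow-dot {h} w z rewrite mod′≡% M (sumFin h (λ j → toℕ (w j) ℕ.* toℕ (z j))) = pow-% γ M γᴹ≈1 _

  character-shift : ∀ {h} (w v u : ZVec M h) b → character w (shift M h v b u) ≈ character w v * pow R (character w u) b
  character-shift {h} w v u b = begin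
    character w (shift M h v b u)
      ≈⟨ character≈pow-dot w _ ⟩
    pow R γ (sumFin h (λ j → W j ℕ.* toℕ (shift M h v b u j)))
      ≈⟨ pow-sumFin-cong h _ _ drop-% ⟩
    pow R γ (sumFin h (λ j → W j ℕ.* (V j ℕ.+ b ℕ.* U j)))
      ≡⟨ ≡.cong (pow R γ) (sumFin-linear h W V U b) ⟩
    pow R γ (w·v ℕ.+ b ℕ.* w·u)
      ≈⟨ pow-+ γ w·v (b ℕ.* w·u) ⟩
    pow R γ w·v * pow R γ (b ℕ.* w·u)
      ≈⟨ *-congˡ (trans (pow-* γ b w·u) (pow-comm γ b w·u)) ⟩
    pow R γ w·v * pow R (pow R γ w·u) b
      ≈⟨ *-cong (character≈pow-dot w v) (pow-cong b (character≈pow-dot w u)) ⟨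
    character w v * pow R (character w u) b ∎
    where
      W V U : Fin h → ℕ
      W = toℕ ∘ w
      V = toℕ ∘ v
      U = toℕ ∘ u
      w·v w·u : ℕ
      w·v = sumFin h (λ j → W j ℕ.* V j)
      w·u = sumFin h (λ j → W j ℕ.* U j)
      drop-% : ∀ j → pow R γ (W j ℕ.* toℕ (shift M h v b u j)) ≈ pow R γ (W j ℕ.* (V j ℕ.+ b ℕ.* U j))
      drop-% j rewrite toℕ-fromℕ< (m%n<n (V j ℕ.+ b ℕ.* U j) M) = begin
        pow R γ (W j ℕ.* ((V j ℕ.+ b ℕ.* U j) ℕ.% M))      ≈⟨ pow-* γ (W j) _ ⟩
        pow R (pow R γ (W j)) ((V j ℕ.+ b ℕ.* U j) ℕ.% M)  ≈⟨ pow-% _ M (pow-pow≈1 γ M γᴹ≈1 (W j)) _ ⟩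
        pow R (pow R γ (W j)) (V j ℕ.+ b ℕ.* U j)          ≈⟨ pow-* γ (W j) _ ⟨
        pow R γ (W j ℕ.* (V j ℕ.+ b ℕ.* U j))              ∎

  a*[x*y]+x*z≈x*[a*y+z] : ∀ a x y z → a * (x * y) + x * z ≈ x * (a * y + z)
  a*[x*y]+x*z≈x*[a*y+z] a x y z = trans (+-congʳ (x∙yz≈y∙xz a x y)) (sym (distribˡ x (a * y) z))

  querySum-linear : ∀ {h n} P (x : Fin n → Carrier) (f : Fin n → ZVec M h → Carrier) v u →
    querySum R M h P (λ z → sumF R n (λ l → x l * f l z)) v u ≈ sumF R n (λ l → x l * querySum R M h P (f l) v u)
  querySum-linear {n = n} [] x f v u = sym (trans (sumF-cong n (λ l → zeroʳ (x l))) (sumF-zero n))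
  querySum-linear {h} {n} ((a , b) ∷ P) x f v u = begin
    a * sumF R n (λ l → x l * f l s) + querySum R M h P (λ z → sumF R n (λ l → x l * f l z)) v u
      ≈⟨ +-cong (*-distribˡ-sumF n a _) (querySum-linear P x f v u) ⟩
    sumF R n (λ l → a * (x l * f l s)) + sumF R n (λ l → x l * querySum R M h P (f l) v u)
      ≈⟨ sumF-distrib-+ n _ _ ⟨
    sumF R n (λ l → a * (x l * f l s) + x l * querySum R M h P (f l) v u)
      ≈⟨ sumF-cong n (λ l → a*[x*y]+x*z≈x*[a*y+z] a (x l) _ _) ⟩
    sumF R n (λ l → x l * querySum R M h ((a , b) ∷ P) (f l) v u) ∎
    where s = shift M h v b u

  querySum-character : ∀ {h} P (w v u : ZVec M h) →
    querySum R M h P (character w) v u ≈ character w v * eval R P (character w u)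
  querySum-character []            w v u = sym (zeroʳ _)
  querySum-character {h} ((a , b) ∷ P) w v u = begin
    a * character w (shift M h v b u) + querySum R M h P (character w) v u
      ≈⟨ +-cong (*-congˡ (character-shift w v u b)) (querySum-character P w v u) ⟩
    a * (character w v * pow R (character w u) b) + character w v * eval R P (character w u)
      ≈⟨ a*[x*y]+x*z≈x*[a*y+z] a _ _ _ ⟩
    character w v * (a * pow R (character w u) b + eval R P (character w u)) ∎

  ip<M : ∀ h (w z : ZVec M h) → ip M h w z < M
  ip<M h w z rewrite mod′≡% M (sumFin h (λ j → toℕ (w j) ℕ.* toℕ (z j))) = m%n<n _ M

  pow-∸*pow≈1 : ∀ {k} → k ≤ M → pow R γ (M ℕ.∸ k) * pow R γ k ≈ 1#
  pow-∸*pow≈1 {k} k≤M = trans (sym (pow-+ γ (M ℕ.∸ k) k))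
    (trans (reflexive (≡.cong (pow R γ) (ℕₚ.m∸n+n≡m k≤M))) γᴹ≈1)

  decode-encode : ∀ {h n} P (u : Fin n → ZVec M h) → IsDecoding R M γ P → Matching M h n u →
                  ∀ x i v → decode R M h n γ P u i (encode R M h n γ u x) v ≈ x i
  decode-encode {h} {n} P u (P-vanishes , P[1]≈1) (self-orthogonal , matching) x i v = begin
    pow R γ (M ℕ.∸ C) * querySum R M h P (encode R M h n γ u x) v (u i)
      ≈⟨ *-congˡ (querySum-linear P x (character ∘ u) v (u i)) ⟩
    pow R γ (M ℕ.∸ C) * sumF R n (λ l → x l * querySum R M h P (character (u l)) v (u i))
      ≈⟨ *-congˡ (sumF-cong n (λ l → *-congˡ (querySum-character P (u l) v (u i)))) ⟩
    pow R γ (M ℕ.∸ C) * sumF R n (λ l → x l * (character (u l) v * eval R P (character (u l) (u i))))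
      ≈⟨ *-congˡ (sumF-single n _ i off-diagonal) ⟩
    pow R γ (M ℕ.∸ C) * (x i * (pow R γ C * eval R P (character (u i) (u i))))
      ≈⟨ *-congˡ (*-congˡ (trans (*-congˡ diagonal) (*-identityʳ _))) ⟩
    pow R γ (M ℕ.∸ C) * (x i * pow R γ C)   ≈⟨ x∙yz≈y∙xz _ (x i) _ ⟩
    x i * (pow R γ (M ℕ.∸ C) * pow R γ C)   ≈⟨ *-congˡ (pow-∸*pow≈1 (ℕₚ.<⇒≤ (ip<M h (u i) v))) ⟩
    x i * 1#                                 ≈⟨ *-identityʳ (x i) ⟩
    x i                                      ∎
    where
      C = ip M h (u i) v
      off-diagonal : ∀ l → l ≢ i → x l * (character (u l) v * eval R P (character (u l) (u i))) ≈ 0#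
      off-diagonal l l≢i =
        trans (*-congˡ (trans (*-congˡ (P-vanishes _ (matching l i l≢i))) (zeroʳ _))) (zeroʳ _)
      diagonal : eval R P (character (u i) (u i)) ≈ 1#
      diagonal = trans (reflexive (≡.cong (λ k → eval R P (pow R γ k)) (self-orthogonal i))) P[1]≈1

open import Data.Nat using (_*_; _^_)

theorem4p8 : ∀ {c ℓ} (R : CommutativeRing c ℓ) (t : ℕ) → IsFiniteFieldOfSize R (2 ^ t) →
    (m₁ m₂ r l t₁ t₂ : ℕ) →
    OddPrimePowerFactorization m₁ r → 1 < r →
    OddPrimePowerFactorization m₂ l → 1 < l →
    gcd m₁ m₂ ≡ 1 →
    MultOrder 2 m₁ t₁ → MultOrder 2 m₂ t₂ → MultOrder 2 (m₁ * m₂) t →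
    (γ γ₁ γ₂ : CommutativeRing.Carrier R) →
    HasOrder R γ (m₁ * m₂) →
    InSubfield R t₁ γ₁ → HasOrder R γ₁ m₁ →
    InSubfield R t₂ γ₂ → HasOrder R γ₂ m₂ →
    (P₁ P₂ : SparsePoly R) →
    WellFormed R P₁ → CoeffsIn R t₁ P₁ → IsDecoding R m₁ γ₁ P₁ →
    WellFormed R P₂ → CoeffsIn R t₂ P₂ → IsDecoding R m₂ γ₂ P₂ →
    Σ (SparsePoly R) λ P →
      WellFormed R P × IsDecoding R (m₁ * m₂) γ P × length P ≤ length P₁ * length P₂ ×
      (∀ {{_ : NonZero (m₁ * m₂)}} (n h : ℕ) → 1 ≤ n → 1 ≤ h →
        (u : Fin n → ZVec (m₁ * m₂) h) → Matching (m₁ * m₂) h n u →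
        (x : Fin n → CommutativeRing.Carrier R) (i : Fin n) (v : ZVec (m₁ * m₂) h) →
        CommutativeRing._≈_ R
          (decode R (m₁ * m₂) h n γ P u i (encode R (m₁ * m₂) h n γ u x) v)
          (x i))
theorem4p8 R t F m₁ m₂ r l t₁ t₂ factorization₁ _ factorization₂ _ gcd≡1 _ _ _ γ γ₁ γ₂ γ-order
           _ (γ₁ᵐ¹≈1 , _) _ (γ₂ᵐ²≈1 , _) P₁ P₂ _ _ P₁-decoding _ _ P₂-decoding
  with DecodingPolynomials.coprime-product R F P₁ P₂
         {{factorization-nonZero factorization₁}} {{factorization-nonZero factorization₂}}
         (gcd≡1⇒coprime gcd≡1) γ-order γ₁ᵐ¹≈1 γ₂ᵐ²≈1 P₁-decoding P₂-decoding
... | P , P-wellFormed , P-decoding , length-bound =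
  P , P-wellFormed , P-decoding , length-bound , λ n h _ _ u u-matching →
    MatchingVectorCodes.decode-encode R γ (m₁ * m₂) (proj₁ γ-order) P u P-decoding u-matching
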